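{- For each $k\ge1$ let $T_k$ be the tree defined recursively by $T_1=K_1$ (with its single vertex as root) and, for $k\ge2$, $T_k$ is obtained from two disjoint copies of $T_{k-1}$ by adding an edge between their roots, the root of $T_k$ being the root of one of the copies. Then $$\lim_{k\to\infty}\bigl(\Gamma(T_k)-z(T_k)\bigr)=+\infty.$$
   Context: $T_k$ has $2^{k-1}$ vertices and is the unique smallest tree with Grundy number $k$. A proper coloring with colors $1,\dots,k$ is a Grundy coloring if for any $i<j$, every vertex of color $j$ has a neighbor of color $i$; $\Gamma(G)$ is the maximum number of colors in a Grundy coloring of $G$. A vertex of color $i$ is color-dominating if it has a neighbor of every other color $j\neq i$ used. A $z$-coloring is a proper coloring using $k$ colors which is a Grundy coloring, in which every color class contains a color-dominating vertex, and which contains color-dominating vertices $u_1,\dots,u_k$ with $u_j$ of color $j$ and $u_k$ adjacent to $u_j$ for every $j\neq k$. $z(G)$ is the maximum number of colors in a $z$-coloring of $G$. -}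

module Defs where

open import Data.Nat using (ℕ; zero; suc; _≤_; _<_; _∸_; _+_)
open import Data.Bool using (Bool; false)
open import Data.Vec using (Vec; []; _∷_; replicate)
open import Data.Product using (Σ; ∃; _×_; _,_)
open import Data.Sum using (_⊎_)
open import Data.Empty using (⊥)
open import Relation.Binary.PropositionalEquality using (_≡_; _≢_)

record Graph : Set₁ where
  field
    V   : Set
    Adj : V → V → Set
open Graph public

-- A coloring is a map V → ℕ; colors are 1,…,k.
module _ (G : Graph) where
  private
    W = V G
    _~_ = Adj G

  IsProperKColoring : ℕ → (W → ℕ) → Set
  IsProperKColoring k c =
    (∀ v → 1 ≤ c v × c v ≤ k) ×
    (∀ u v → u ~ v → c u ≢ c v) ×
    (∀ j → 1 ≤ j → j ≤ k → ∃ λ v → c v ≡ j)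

  IsGrundy : ℕ → (W → ℕ) → Set
  IsGrundy k c =
    IsProperKColoring k c ×
    (∀ v i → 1 ≤ i → i < c v → ∃ λ u → v ~ u × c u ≡ i)

  ColorDominating : ℕ → (W → ℕ) → W → Set
  ColorDominating k c v =
    ∀ j → 1 ≤ j → j ≤ k → j ≢ c v → ∃ λ u → v ~ u × c u ≡ j

  IsZColoring : ℕ → (W → ℕ) → Set
  IsZColoring k c =
    IsGrundy k c ×
    (∀ j → 1 ≤ j → j ≤ k → ∃ λ v → c v ≡ j × ColorDominating k c v) ×
    (∃ λ (u : ℕ → W) →
       ∀ j → 1 ≤ j → j ≤ k →
         c (u j) ≡ j × ColorDominating k c (u j) × (j ≢ k → u k ~ u j))

  GrundyNumberIs : ℕ → Set
  GrundyNumberIs g =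
    (∃ λ c → IsGrundy g c) × (∀ k c → IsGrundy k c → k ≤ g)

  ZNumberIs : ℕ → Set
  ZNumberIs g =
    (∃ λ c → IsZColoring g c) × (∀ k c → IsZColoring k c → k ≤ g)

-- The trees T_{m+1}: vertices are bit strings of length m (2^m vertices).
-- T_1 = K_1 with root [];  T_{m+2} consists of two copies (first bit b)
-- of T_{m+1}, with an edge between the two copies' roots; the root is
-- the root of copy 'false'.
root : (m : ℕ) → Vec Bool m
root m = replicate m false

TAdj : (m : ℕ) → Vec Bool m → Vec Bool m → Set
TAdj zero [] [] = ⊥
TAdj (suc m) (b ∷ v) (b' ∷ v') =
  (b ≡ b' × TAdj m v v') ⊎ (b ≢ b' × v ≡ root m × v' ≡ root m)

-- T k (meaningful for k ≥ 1): the tree T_k, on vertex set Vec Bool (k ∸ 1)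
T : ℕ → Graph
T k = record { V = Vec Bool (k ∸ 1) ; Adj = TAdj (k ∸ 1) }

-- Colouring a vertex of T k by one more than its number of children is a Grundy
-- colouring with k colours, and no Grundy colouring has more than Δ + 1 = k colours,
-- so Γ(T k) = k.  A vertex with ℓ children has at most ℓ + 1 neighbours, so in a
-- z-colouring with n colours every colour-dominating vertex has ℓ ≥ n − 2.  The
-- central vertex u_n sees the n − 1 other u_j, all with ℓ ≥ n − 2, but its closed
-- neighbourhood contains at most one child of each smaller ℓ, one parent and itself,
-- hence at most ℓ(u_n) + 4 − n vertices with ℓ ≥ n − 2.  Thus 2n ≤ k + 3, and
-- Γ(T k) − z(T k) ≥ (k − 3)/2.  That z(T k) exists at all is a finite search:
-- z-colourability with n colours is decidable, and n is bounded by Γ(T k).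
module Submission where

open import Defs
open import Data.Bool using (Bool; true; false; not; _xor_; if_then_else_) renaming (_≟_ to _≟ᵇ_)
open import Data.Bool.Properties using (¬-not)
open import Data.Empty using (⊥-elim)
open import Data.Fin using (Fin; toℕ; fromℕ<)
import Data.Fin.Properties as Fin
open import Data.Nat hiding (parity)
open import Data.Nat.Properties
open import Data.Product
open import Data.Sum using (_⊎_; inj₁; inj₂)
open import Data.Vec using (Vec; []; _∷_)
open import Data.Vec.Properties using (≡-dec)
open import Function using (_∘_)
open import Relation.Nullary
open import Relation.Nullary.Decidable using (map′; _×-dec_; _⊎-dec_; _→-dec_; ¬?; decidable-stable)
import Relation.Unary as U
open import Relation.Binary.Definitions using (DecidableEquality; Decidable)
open import Relation.Binary.PropositionalEquality

isRoot : ∀ {m} → Vec Bool m → Bool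
isRoot []          = true
isRoot (true ∷ _)  = false
isRoot (false ∷ v) = isRoot v

root? : ∀ {m} (v : Vec Bool m) → isRoot v ≡ true ⊎ isRoot v ≡ false
root? v with isRoot v
... | true  = inj₁ refl
... | false = inj₂ refl

isRoot-root : ∀ m → isRoot (root m) ≡ true
isRoot-root zero    = refl
isRoot-root (suc m) = isRoot-root m

isRoot⇒≡root : ∀ {m} (v : Vec Bool m) → isRoot v ≡ true → v ≡ root m
isRoot⇒≡root []          _ = refl
isRoot⇒≡root (false ∷ v) r = cong (false ∷_) (isRoot⇒≡root v r)

-- The number of trailing falses of v: in T (suc m), v has level v children and,
-- unless it is the root, one parent.
level : ∀ {m} → Vec Bool m → ℕ
level []              = 0
level {suc m} (b ∷ v) = if isRoot v then (if b then m else suc m) else level v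

level≤ : ∀ {m} (v : Vec Bool m) → level v ≤ m
level≤ [] = z≤n
level≤ {suc m} (b ∷ v) with isRoot v
level≤ {suc m} (true  ∷ v) | true  = n≤1+n m
level≤ {suc m} (false ∷ v) | true  = ≤-refl
level≤ {suc m} (b     ∷ v) | false = m≤n⇒m≤1+n (level≤ v)

level-isRoot : ∀ {m} (v : Vec Bool m) → isRoot v ≡ true → level v ≡ m
level-isRoot []          _ = refl
level-isRoot (false ∷ v) r rewrite r = refl

level-root : ∀ m → level (root m) ≡ m
level-root m = level-isRoot (root m) (isRoot-root m)

level<-nonroot : ∀ {m} (v : Vec Bool m) → isRoot v ≡ false → level v < m
level<-nonroot {suc m} (true ∷ v) _ with isRoot v
... | true  = ≤-refl
... | false = s≤s (level≤ v)
level<-nonroot {suc m} (false ∷ v) r rewrite r = m<n⇒m<1+n (level<-nonroot v r)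

level-cons-nonroot : ∀ {m} b (v : Vec Bool m) → isRoot v ≡ false → level (b ∷ v) ≡ level v
level-cons-nonroot b v r rewrite r = refl

level-cons-below : ∀ {m} b (v : Vec Bool m) → level v < m → level (b ∷ v) ≡ level v
level-cons-below b v l with isRoot v in r
... | true  = ⊥-elim (<-irrefl (level-isRoot v r) l)
... | false = refl

m≤level-cons-root : ∀ {m} b (v : Vec Bool m) → isRoot v ≡ true → m ≤ level (b ∷ v)
m≤level-cons-root b v r rewrite r = m≤top b
  where
  m≤top : ∀ {m} b → m ≤ (if b then m else suc m)
  m≤top true  = ≤-refl
  m≤top false = n≤1+n _

level-cons-nonroot<root : ∀ {m} b b' (v w : Vec Bool m) → isRoot v ≡ false → isRoot w ≡ true →
                          level (b ∷ v) < level (b' ∷ w)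
level-cons-nonroot<root b b' v w rv rw =
  <-≤-trans (subst (_< _) (sym (level-cons-nonroot b v rv)) (level<-nonroot v rv)) (m≤level-cons-root b' w rw)

level-cons>m : ∀ {m} b (v : Vec Bool m) → m < level (b ∷ v) → b ≡ false × v ≡ root m
level-cons>m b v l with isRoot v in r
level-cons>m true  v l | true  = ⊥-elim (<-irrefl refl l)
level-cons>m false v l | true  = refl , isRoot⇒≡root v r
level-cons>m b     v l | false = ⊥-elim (<-asym l (level<-nonroot v r))

cross-level≢ : ∀ m {b b'} → b ≢ b' → level (b ∷ root m) ≢ level (b' ∷ root m)
cross-level≢ m {true}  {true}  b≢b' = ⊥-elim (b≢b' refl)
cross-level≢ m {true}  {false} _ rewrite isRoot-root m = <⇒≢ ≤-refl
cross-level≢ m {false} {true}  _ rewrite isRoot-root m = >⇒≢ ≤-refl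
cross-level≢ m {false} {false} b≢b' = ⊥-elim (b≢b' refl)

adjacent⇒level≢ : ∀ m {v w : Vec Bool m} → TAdj m v w → level v ≢ level w
adjacent⇒level≢ zero {[]} {[]} ()
adjacent⇒level≢ (suc m) {b ∷ v} {.b ∷ w} (inj₁ (refl , vw)) with root? v | root? w
... | inj₂ rv | inj₂ rw = subst₂ _≢_ (sym (level-cons-nonroot b v rv)) (sym (level-cons-nonroot b w rw))
                            (adjacent⇒level≢ m vw)
... | inj₁ rv | inj₁ rw = ⊥-elim (adjacent⇒level≢ m vw (trans (level-isRoot v rv) (sym (level-isRoot w rw))))
... | inj₁ rv | inj₂ rw = >⇒≢ (level-cons-nonroot<root b b w v rw rv)
... | inj₂ rv | inj₁ rw = <⇒≢ (level-cons-nonroot<root b b v w rv rw)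
adjacent⇒level≢ (suc m) {_ ∷ _} {_ ∷ _} (inj₂ (b≢b' , refl , refl)) = cross-level≢ m b≢b'

TAdj-irrefl : ∀ m {v : Vec Bool m} → ¬ TAdj m v v
TAdj-irrefl m vv = adjacent⇒level≢ m vv refl

root-neighbour-nonroot : ∀ m {w} → TAdj m (root m) w → isRoot w ≡ false
root-neighbour-nonroot m {w} a with root? w
... | inj₂ r = r
... | inj₁ r = ⊥-elim (TAdj-irrefl m (subst (TAdj m (root m)) (isRoot⇒≡root w r) a))

root-neighbour-below : ∀ m b b' {w} → TAdj m (root m) w → level (b ∷ w) < level (b' ∷ root m)
root-neighbour-below m b b' {w} a =
  level-cons-nonroot<root b b' w (root m) (root-neighbour-nonroot m a) (isRoot-root m)

both≢⇒≡ : ∀ {b b₁ b₂ : Bool} → b ≢ b₁ → b ≢ b₂ → b₁ ≡ b₂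
both≢⇒≡ b≢b₁ b≢b₂ = trans (¬-not (≢-sym b≢b₁)) (sym (¬-not (≢-sym b≢b₂)))

adjacent-level-injective : ∀ m {v w w' : Vec Bool m} → TAdj m v w → TAdj m v w' →
                           level w ≡ level w' → w ≡ w'
adjacent-level-injective zero {[]} {[]} ()
adjacent-level-injective (suc m) {b ∷ v} {.b ∷ w} {.b ∷ w'} (inj₁ (refl , vw)) (inj₁ (refl , vw')) e
  with root? w | root? w'
... | inj₁ rw | inj₁ rw' = cong (b ∷_) (trans (isRoot⇒≡root w rw) (sym (isRoot⇒≡root w' rw')))
... | inj₂ rw | inj₂ rw' = cong (b ∷_) (adjacent-level-injective m vw vw'
                              (trans (sym (level-cons-nonroot b w rw)) (trans e (level-cons-nonroot b w' rw'))))
... | inj₁ rw | inj₂ rw' = ⊥-elim (>⇒≢ (level-cons-nonroot<root b b w' w rw' rw) e)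
... | inj₂ rw | inj₁ rw' = ⊥-elim (<⇒≢ (level-cons-nonroot<root b b w w' rw rw') e)
adjacent-level-injective (suc m) {b ∷ _} {.b ∷ w} {_ ∷ _} (inj₁ (refl , vw)) (inj₂ (_ , refl , refl)) e =
  ⊥-elim (<⇒≢ (root-neighbour-below m b _ vw) e)
adjacent-level-injective (suc m) {b ∷ _} {_ ∷ _} {.b ∷ w'} (inj₂ (_ , refl , refl)) (inj₁ (refl , vw')) e =
  ⊥-elim (>⇒≢ (root-neighbour-below m b _ vw') e)
adjacent-level-injective (suc m) {_ ∷ _} {_ ∷ _} {_ ∷ _} (inj₂ (b≢b₁ , refl , refl)) (inj₂ (b≢b₂ , _ , refl)) _ =
  cong (_∷ root m) (both≢⇒≡ b≢b₁ b≢b₂)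

upper-neighbour-unique : ∀ m {v w w' : Vec Bool m} → TAdj m v w → TAdj m v w' →
                         level v < level w → level v < level w' → w ≡ w'
upper-neighbour-unique zero {[]} {[]} ()
upper-neighbour-unique (suc m) {b ∷ v} {.b ∷ w} {.b ∷ w'} (inj₁ (refl , vw)) (inj₁ (refl , vw')) l l'
  with root? v
... | inj₂ rv = cong (b ∷_) (upper-neighbour-unique m vw vw' (drop-head w l) (drop-head w' l'))
  where
  drop-head : ∀ u → level (b ∷ v) < level (b ∷ u) → level v < level u
  drop-head u lu with root? u
  ... | inj₁ ru = subst (level v <_) (sym (level-isRoot u ru)) (level<-nonroot v rv)
  ... | inj₂ ru = subst₂ _<_ (level-cons-nonroot b v rv) (level-cons-nonroot b u ru) lu
... | inj₁ rv with isRoot⇒≡root v rv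
...   | refl = ⊥-elim (<-asym l (root-neighbour-below m b b vw))
upper-neighbour-unique (suc m) {b ∷ _} {.b ∷ w} {_ ∷ _} (inj₁ (refl , vw)) (inj₂ (_ , refl , refl)) l _ =
  ⊥-elim (<-asym l (root-neighbour-below m b b vw))
upper-neighbour-unique (suc m) {b ∷ _} {_ ∷ _} {.b ∷ w'} (inj₂ (_ , refl , refl)) (inj₁ (refl , vw')) _ l' =
  ⊥-elim (<-asym l' (root-neighbour-below m b b vw'))
upper-neighbour-unique (suc m) {_ ∷ _} {_ ∷ _} {_ ∷ _} (inj₂ (b≢b₁ , refl , refl)) (inj₂ (b≢b₂ , _ , refl)) _ _ =
  cong (_∷ root m) (both≢⇒≡ b≢b₁ b≢b₂)

lower-neighbour : ∀ m (v : Vec Bool m) {s} → s < level v → ∃ λ w → TAdj m v w × level w ≡ s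
lower-neighbour zero [] ()
lower-neighbour (suc m) (b ∷ v) {s} s<l with s ≟ m
... | yes refl with level-cons>m b v s<l
...   | refl , refl = true ∷ root m , inj₂ ((λ ()) , refl , refl) , level-root-true
  where
  level-root-true : level (true ∷ root m) ≡ m
  level-root-true rewrite isRoot-root m = refl
lower-neighbour (suc m) (b ∷ v) {s} s<l | no s≢m =
  let (w , vw , lw≡s) = lower-neighbour m v s<level-tail
  in  b ∷ w , inj₁ (refl , vw) , trans (level-cons-below b w (subst (_< m) (sym lw≡s) s<m)) lw≡s
  where
  s<m : s < m
  s<m = ≤∧≢⇒< (≤-pred (<-≤-trans s<l (level≤ (b ∷ v)))) s≢m
  s<level-tail : s < level v
  s<level-tail with root? v
  ... | inj₁ rv = subst (s <_) (sym (level-isRoot v rv)) s<m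
  ... | inj₂ rv = subst (s <_) (level-cons-nonroot b v rv) s<l

level-surjective : ∀ m {s} → s ≤ m → ∃ λ (v : Vec Bool m) → level v ≡ s
level-surjective m {s} s≤m with s ≟ m
... | yes refl = root m , level-root m
... | no s≢m   = let (w , _ , lw≡s) = lower-neighbour m (root m) (subst (s <_) (sym (level-root m)) (≤∧≢⇒< s≤m s≢m))
                 in  w , lw≡s

neighbour-below-or-above : ∀ m {v w : Vec Bool m} → TAdj m v w → level w < level v ⊎ level v < level w
neighbour-below-or-above m {v} {w} vw with level w <? level v
... | yes lw<lv = inj₁ lw<lv
... | no  lw≮lv = inj₂ (≤∧≢⇒< (≮⇒≥ lw≮lv) (adjacent⇒level≢ m vw))

neighbour-⊓<m : ∀ m {v w : Vec Bool m} → TAdj m v w → level v ⊓ level w < m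
neighbour-⊓<m m {v} {w} vw with neighbour-below-or-above m vw
... | inj₁ lw<lv = m<n⇒o⊓m<n (level v) (<-≤-trans lw<lv (level≤ v))
... | inj₂ lv<lw = m<n⇒m⊓o<n (level w) (<-≤-trans lv<lw (level≤ w))

neighbour-⊓-injective : ∀ m {v w w' : Vec Bool m} → TAdj m v w → TAdj m v w' →
                        level v ⊓ level w ≡ level v ⊓ level w' → w ≡ w'
neighbour-⊓-injective m {v} {w} {w'} vw vw' e
  with neighbour-below-or-above m vw | neighbour-below-or-above m vw'
... | inj₁ lw<lv | inj₁ lw'<lv = adjacent-level-injective m vw vw'
  (trans (sym (m≥n⇒m⊓n≡n (<⇒≤ lw<lv))) (trans e (m≥n⇒m⊓n≡n (<⇒≤ lw'<lv))))
... | inj₂ lv<lw | inj₂ lv<lw' = upper-neighbour-unique m vw vw' lv<lw lv<lw'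
... | inj₁ lw<lv | inj₂ lv<lw' =
  ⊥-elim (<⇒≢ lw<lv (trans (sym (m≥n⇒m⊓n≡n (<⇒≤ lw<lv))) (trans e (m≤n⇒m⊓n≡m (<⇒≤ lv<lw')))))
... | inj₂ lv<lw | inj₁ lw'<lv =
  ⊥-elim (<⇒≢ lw'<lv (trans (sym (m≥n⇒m⊓n≡n (<⇒≤ lw'<lv))) (trans (sym e) (m≤n⇒m⊓n≡m (<⇒≤ lv<lw)))))

Near : ∀ m → Vec Bool m → Vec Bool m → Set
Near m v w = w ≡ v ⊎ TAdj m v w

_≟ᵛ_ : ∀ {m} → DecidableEquality (Vec Bool m)
_≟ᵛ_ = ≡-dec _≟ᵇ_

-- An injective code of the closed neighbourhood of v into [0, level v + 2): a
-- neighbour of v is coded by the smaller of the two levels (lower neighbours have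
-- distinct levels, and there is at most one upper neighbour).
code : ∀ {m} → Vec Bool m → Vec Bool m → ℕ
code v w with w ≟ᵛ v
... | yes _ = suc (level v)
... | no  _ = level v ⊓ level w

code-self : ∀ {m} (v : Vec Bool m) → code v v ≡ suc (level v)
code-self v with v ≟ᵛ v
... | yes _   = refl
... | no  v≢v = ⊥-elim (v≢v refl)

code-neighbour : ∀ m {v w : Vec Bool m} → TAdj m v w → code v w ≡ level v ⊓ level w
code-neighbour m {v} {w} vw with w ≟ᵛ v
... | yes refl = ⊥-elim (TAdj-irrefl m vw)
... | no  _    = refl

code-neighbour≤level : ∀ m {v w : Vec Bool m} → TAdj m v w → code v w ≤ level v
code-neighbour≤level m vw = subst (_≤ _) (sym (code-neighbour m vw)) (m⊓n≤m _ _)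

code-injective : ∀ m {v w w' : Vec Bool m} → Near m v w → Near m v w' → code v w ≡ code v w' → w ≡ w'
code-injective m (inj₁ refl) (inj₁ refl) _ = refl
code-injective m {v} (inj₁ refl) (inj₂ vw') e =
  ⊥-elim (1+n≰n (≤-trans (≤-reflexive (trans (sym (code-self v)) e)) (code-neighbour≤level m vw')))
code-injective m {v} (inj₂ vw) (inj₁ refl) e =
  ⊥-elim (1+n≰n (≤-trans (≤-reflexive (trans (sym (code-self v)) (sym e))) (code-neighbour≤level m vw)))
code-injective m (inj₂ vw) (inj₂ vw') e =
  neighbour-⊓-injective m vw vw' (trans (sym (code-neighbour m vw)) (trans e (code-neighbour m vw')))

code≤ : ∀ m {v w : Vec Bool m} → Near m v w → code v w ≤ suc (level v)
code≤ m {v} (inj₁ refl) = ≤-reflexive (code-self v)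
code≤ m     (inj₂ vw)   = m≤n⇒m≤1+n (code-neighbour≤level m vw)

code-neighbour<m : ∀ m {v w : Vec Bool m} → TAdj m v w → code v w < m
code-neighbour<m m vw = subst (_< m) (sym (code-neighbour m vw)) (neighbour-⊓<m m vw)

code≥ : ∀ m {v w : Vec Bool m} {lo} → Near m v w → lo ≤ level v → lo ≤ level w → lo ≤ code v w
code≥ m {v} (inj₁ refl) lo≤lv _ = subst (_ ≤_) (sym (code-self v)) (m≤n⇒m≤1+n lo≤lv)
code≥ m     (inj₂ vw)   lo≤lv lo≤lw = subst (_ ≤_) (sym (code-neighbour m vw)) (⊓-glb lo≤lv lo≤lw)

bounded-injection : ∀ {n lo p} (f : ∀ a → a < n → ℕ) →
                    (∀ {a} (a<n : a < n) → lo ≤ f a a<n × f a a<n < p) →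
                    (∀ {a b} (a<n : a < n) (b<n : b < n) → f a a<n ≡ f b b<n → a ≡ b) →
                    n ≤ p ∸ lo
bounded-injection {n} {lo} {p} f range injective = Fin.injective⇒≤ {f = g} g-injective
  where
  g : Fin n → Fin (p ∸ lo)
  g i = fromℕ< (∸-monoˡ-< (proj₂ (range (Fin.toℕ<n i))) (proj₁ (range (Fin.toℕ<n i))))
  g-injective : ∀ {i j} → g i ≡ g j → i ≡ j
  g-injective {i} {j} e = Fin.toℕ-injective (injective (Fin.toℕ<n i) (Fin.toℕ<n j)
    (∸-cancelʳ-≡ (proj₁ (range (Fin.toℕ<n i))) (proj₁ (range (Fin.toℕ<n j)))
      (trans (sym (Fin.toℕ-fromℕ< _)) (trans (cong toℕ e) (Fin.toℕ-fromℕ< _)))))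

palette-bound : ∀ m (c : Vec Bool m → ℕ) (v : Vec Bool m) n {lo p} →
                (∀ {a} → a < n → ∃ λ w → Near m v w × c w ≡ suc a × lo ≤ code v w × code v w < p) →
                n ≤ p ∸ lo
palette-bound m c v n {lo} {p} palette =
  bounded-injection (λ _ a<n → code v (proj₁ (palette a<n))) range injective
  where
  range : ∀ {a} (a<n : a < n) → lo ≤ code v (proj₁ (palette a<n)) × code v (proj₁ (palette a<n)) < p
  range a<n = let (_ , _ , _ , lo≤ , <p) = palette a<n in lo≤ , <p
  injective : ∀ {a b} (a<n : a < n) (b<n : b < n) →
              code v (proj₁ (palette a<n)) ≡ code v (proj₁ (palette b<n)) → a ≡ b
  injective a<n b<n e =
    let (w , vw , cw , _) = palette a<n
        (w' , vw' , cw' , _) = palette b<n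
    in  suc-injective (trans (sym cw) (trans (cong c (code-injective m vw vw' e)) cw'))

grundy-bound : ∀ m {k c} → IsGrundy (T (suc m)) k c → k ≤ suc m
grundy-bound m {zero} _ = z≤n
grundy-bound m {suc k} {c} ((_ , _ , onto) , grundy) =
  let (v , cv≡1+k) = onto (suc k) (s≤s z≤n) ≤-refl
  in  s≤s (palette-bound m c v k λ {a} a<k →
        let (w , vw , cw) = grundy v (suc a) (s≤s z≤n) (subst (suc a <_) (sym cv≡1+k) (s≤s a<k))
        in  w , inj₂ vw , cw , z≤n , code-neighbour<m m vw)

colour-dominating-bound : ∀ m {k c} {v : Vec Bool m} → ColorDominating (T (suc m)) k c v → k ≤ 2 + level v
colour-dominating-bound m {k} {c} {v} dominating = palette-bound m c v k palette
  where
  palette : ∀ {a} → a < k → ∃ λ w → Near m v w × c w ≡ suc a × 0 ≤ code v w × code v w < 2 + level v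
  palette {a} a<k with suc a ≟ c v
  ... | yes 1+a≡cv = v , inj₁ refl , sym 1+a≡cv , z≤n , s≤s (code≤ m {v} (inj₁ refl))
  ... | no  1+a≢cv = let (w , vw , cw) = dominating (suc a) (s≤s z≤n) a<k 1+a≢cv
                     in  w , inj₂ vw , cw , z≤n , s≤s (code≤ m (inj₂ vw))

z-colouring-bound : ∀ m {k c} → IsZColoring (T (suc m)) k c → k + (k ∸ 2) ≤ 2 + m
z-colouring-bound m {zero} _ = z≤n
z-colouring-bound m {suc n} {c} (_ , _ , u , central) =
  ≤-trans (m≤o∸n⇒m+n≤o (suc n) (≤-trans lo≤level-U (m≤n+m _ 2)) palette-bound-at-U) (s≤s (s≤s (level≤ U)))
  where
  U = u (suc n)
  lo≤level : ∀ {w} → ColorDominating (T (suc m)) (suc n) c w → suc n ∸ 2 ≤ level w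
  lo≤level dominating = m≤n+o⇒m∸n≤o (suc n) 2 (colour-dominating-bound m dominating)
  lo≤level-U : suc n ∸ 2 ≤ level U
  lo≤level-U = lo≤level (proj₁ (proj₂ (central (suc n) (s≤s z≤n) ≤-refl)))
  palette-bound-at-U : suc n ≤ 2 + level U ∸ (suc n ∸ 2)
  palette-bound-at-U = palette-bound m c U (suc n) λ {a} a<k →
    let (cu , dominating , adjacent) = central (suc a) (s≤s z≤n) a<k
        near = near-U a adjacent
    in  u (suc a) , near , cu , code≥ m near lo≤level-U (lo≤level dominating) , s≤s (code≤ m near)
    where
    near-U : ∀ a → (suc a ≢ suc n → TAdj m U (u (suc a))) → Near m U (u (suc a))
    near-U a adjacent with suc a ≟ suc n
    ... | yes 1+a≡1+n = inj₁ (cong u 1+a≡1+n)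
    ... | no  1+a≢1+n = inj₂ (adjacent 1+a≢1+n)

level-colouring-grundy : ∀ m → IsGrundy (T (suc m)) (suc m) (λ v → suc (level v))
level-colouring-grundy m =
  ((λ v → s≤s z≤n , s≤s (level≤ v)) , (λ _ _ vw e → adjacent⇒level≢ m vw (suc-injective e)) , onto) , grundy
  where
  onto : ∀ j → 1 ≤ j → j ≤ suc m → ∃ λ v → suc (level v) ≡ j
  onto (suc s) _ (s≤s s≤m) = let (v , lv≡s) = level-surjective m s≤m in v , cong suc lv≡s
  grundy : ∀ v i → 1 ≤ i → i < suc (level v) → ∃ λ w → TAdj m v w × suc (level w) ≡ i
  grundy v (suc s) _ (s≤s s<lv) = let (w , vw , lw≡s) = lower-neighbour m v s<lv in w , vw , cong suc lw≡s

parity : ∀ {m} → Vec Bool m → Bool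
parity []      = false
parity (b ∷ v) = b xor parity v

parity-root : ∀ m → parity (root m) ≡ false
parity-root zero    = refl
parity-root (suc m) = parity-root m

parity-adjacent : ∀ m {v w : Vec Bool m} → TAdj m v w → parity w ≡ not (parity v)
parity-adjacent zero {[]} {[]} ()
parity-adjacent (suc m) {b ∷ v} {.b ∷ w} (inj₁ (refl , vw)) rewrite parity-adjacent m vw = xor-not b (parity v)
  where
  xor-not : ∀ b x → b xor not x ≡ not (b xor x)
  xor-not true  x = refl
  xor-not false x = refl
parity-adjacent (suc m) {b ∷ _} {b' ∷ _} (inj₂ (b≢b' , refl , refl))
  rewrite parity-root m | ¬-not (≢-sym b≢b') = not-xor-false b
  where
  not-xor-false : ∀ b → not b xor false ≡ not (b xor false)
  not-xor-false true  = refl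
  not-xor-false false = refl

has-neighbour : ∀ m (v : Vec Bool (suc m)) → ∃ λ w → TAdj (suc m) v w
has-neighbour m (b ∷ v) with v ≟ᵛ root m
... | yes refl = not b ∷ root m , inj₂ (b≢not-b b , refl , refl)
  where
  b≢not-b : ∀ b → b ≢ not b
  b≢not-b true  ()
  b≢not-b false ()
has-neighbour zero    (b ∷ []) | no []≢[] = ⊥-elim ([]≢[] refl)
has-neighbour (suc m) (b ∷ v)  | no _     = let (w , vw) = has-neighbour m v in b ∷ w , inj₁ (refl , vw)

bit-colour : Bool → ℕ
bit-colour false = 1
bit-colour true  = 2

bit-colour-range : ∀ b → 1 ≤ bit-colour b × bit-colour b ≤ 2
bit-colour-range false = s≤s z≤n , s≤s z≤n
bit-colour-range true  = s≤s z≤n , ≤-refl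

bit-colour-not : ∀ b {j} → 1 ≤ j → j ≤ 2 → j ≢ bit-colour b → bit-colour (not b) ≡ j
bit-colour-not _     {suc (suc (suc _))} _ (s≤s (s≤s ()))
bit-colour-not false {1} _ _ 1≢1 = ⊥-elim (1≢1 refl)
bit-colour-not false {2} _ _ _   = refl
bit-colour-not true  {1} _ _ _   = refl
bit-colour-not true  {2} _ _ 2≢2 = ⊥-elim (2≢2 refl)

bit-colour-≢-not : ∀ b → bit-colour b ≢ bit-colour (not b)
bit-colour-≢-not false ()
bit-colour-≢-not true  ()

module ParityColouring (m : ℕ) where

  colour : Vec Bool (suc m) → ℕ
  colour v = bit-colour (parity v)

  dominating : ∀ v → ColorDominating (T (suc (suc m))) 2 colour v
  dominating v j 1≤j j≤2 j≢cv =
    let (w , vw) = has-neighbour m v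
    in  w , vw , trans (cong bit-colour (parity-adjacent (suc m) vw)) (bit-colour-not (parity v) 1≤j j≤2 j≢cv)

  u : ℕ → Vec Bool (suc m)
  u 1 = root (suc m)
  u _ = true ∷ root m

  colour-u : ∀ j → 1 ≤ j → j ≤ 2 → colour (u j) ≡ j
  colour-u 1 _ _ = cong bit-colour (parity-root m)
  colour-u 2 _ _ = cong (λ x → bit-colour (true xor x)) (parity-root m)
  colour-u (suc (suc (suc _))) _ (s≤s (s≤s ()))

  u2-adjacent : ∀ j → 1 ≤ j → j ≤ 2 → j ≢ 2 → TAdj (suc m) (u 2) (u j)
  u2-adjacent 1 _ _ _ = inj₂ ((λ ()) , refl , refl)
  u2-adjacent 2 _ _ 2≢2 = ⊥-elim (2≢2 refl)
  u2-adjacent (suc (suc (suc _))) _ (s≤s (s≤s ()))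

  z-colouring : IsZColoring (T (suc (suc m))) 2 colour
  z-colouring =
    (((λ v → bit-colour-range (parity v)) , proper , λ j 1≤j j≤2 → u j , colour-u j 1≤j j≤2) , grundy) ,
    (λ j 1≤j j≤2 → u j , colour-u j 1≤j j≤2 , dominating (u j)) ,
    u , λ j 1≤j j≤2 → colour-u j 1≤j j≤2 , dominating (u j) , u2-adjacent j 1≤j j≤2
    where
    proper : ∀ v w → TAdj (suc m) v w → colour v ≢ colour w
    proper v w vw = subst (colour v ≢_) (cong bit-colour (sym (parity-adjacent (suc m) vw)))
                      (bit-colour-≢-not (parity v))
    grundy : ∀ v i → 1 ≤ i → i < colour v → ∃ λ w → TAdj (suc m) v w × colour w ≡ i
    grundy v i 1≤i i<cv = dominating v i 1≤i (≤-trans (<⇒≤ i<cv) (proj₂ (bit-colour-range (parity v)))) (<⇒≢ i<cv)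

single-vertex-z-colouring : IsZColoring (T 1) 1 (λ _ → 1)
single-vertex-z-colouring =
  (((λ _ → ≤-refl , ≤-refl) , (λ { [] [] () }) , λ { 1 _ _ → [] , refl ; (suc (suc _)) _ (s≤s ()) }) ,
   λ { _ (suc _) _ (s≤s ()) }) ,
  (λ { 1 _ _ → [] , refl , dominating ; (suc (suc _)) _ (s≤s ()) }) ,
  (λ _ → []) , λ { 1 _ _ → refl , dominating , (λ 1≢1 → ⊥-elim (1≢1 refl)) ; (suc (suc _)) _ (s≤s ()) }
  where
  dominating : ColorDominating (T 1) 1 (λ _ → 1) []
  dominating 1 _ _ 1≢1 = ⊥-elim (1≢1 refl)
  dominating (suc (suc _)) _ (s≤s ())

some-z-colouring : ∀ m → ∃₂ λ k c → IsZColoring (T (suc m)) k c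
some-z-colouring zero    = 1 , (λ _ → 1) , single-vertex-z-colouring
some-z-colouring (suc m) = 2 , ParityColouring.colour m , ParityColouring.z-colouring m

module _ (G : Graph) {k : ℕ} {c c' : V G → ℕ} (c≗c' : ∀ v → c v ≡ c' v) where

  ColorDominating-resp-≗ : ∀ {v} → ColorDominating G k c v → ColorDominating G k c' v
  ColorDominating-resp-≗ {v} dominating j 1≤j j≤k j≢c'v =
    let (w , vw , cw) = dominating j 1≤j j≤k (λ j≡cv → j≢c'v (trans j≡cv (c≗c' v)))
    in  w , vw , trans (sym (c≗c' w)) cw

  IsZColoring-resp-≗ : IsZColoring G k c → IsZColoring G k c'
  IsZColoring-resp-≗ (((range , proper , onto) , grundy) , dominating , u , central) =
    (((λ v → subst (λ x → 1 ≤ x × x ≤ k) (c≗c' v) (range v)) ,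
      (λ v w vw e → proper v w vw (trans (c≗c' v) (trans e (sym (c≗c' w))))) ,
      (λ j 1≤j j≤k → let (v , cv) = onto j 1≤j j≤k in v , trans (sym (c≗c' v)) cv)) ,
     (λ v i 1≤i i<c'v → let (w , vw , cw) = grundy v i 1≤i (subst (i <_) (sym (c≗c' v)) i<c'v)
                        in  w , vw , trans (sym (c≗c' w)) cw)) ,
    (λ j 1≤j j≤k → let (v , cv , dv) = dominating j 1≤j j≤k
                   in  v , trans (sym (c≗c' v)) cv , ColorDominating-resp-≗ dv) ,
    u , λ j 1≤j j≤k → let (cu , du , adjacent) = central j 1≤j j≤k
                      in  trans (sym (c≗c' (u j))) cu , ColorDominating-resp-≗ du , adjacent

Exhaustible : Set → Set₁
Exhaustible A = ∀ {P : A → Set} → U.Decidable P → Dec (∃ P)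

∀? : ∀ {A} → Exhaustible A → ∀ {P : A → Set} → U.Decidable P → Dec (∀ x → P x)
∀? ∃? P? = map′ (λ ¬∃¬P x → decidable-stable (P? x) (λ ¬Px → ¬∃¬P (x , ¬Px)))
                (λ ∀P (x , ¬Px) → ¬Px (∀P x))
                (¬? (∃? (¬? ∘ P?)))

Bool-exhaustible : Exhaustible Bool
Bool-exhaustible P? = map′ (λ { (inj₁ p) → true , p ; (inj₂ p) → false , p })
                           (λ { (true , p) → inj₁ p ; (false , p) → inj₂ p })
                           (P? true ⊎-dec P? false)

Vec-exhaustible : ∀ {A} → Exhaustible A → ∀ m → Exhaustible (Vec A m)
Vec-exhaustible ∃? zero    P? = map′ ([] ,_) (λ { ([] , p) → p }) (P? [])
Vec-exhaustible ∃? (suc m) P? = map′ (λ (x , xs , p) → x ∷ xs , p) (λ { (x ∷ xs , p) → x , xs , p })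
                                     (∃? λ x → Vec-exhaustible ∃? m (P? ∘ (x ∷_)))

∀-between? : ∀ k {P : ℕ → Set} → U.Decidable P → Dec (∀ j → 1 ≤ j → j ≤ k → P j)
∀-between? k P? = map′ (λ ∀P j 1≤j j≤k → ∀P (s≤s j≤k) 1≤j) (λ ∀P {j} j<1+k 1≤j → ∀P j 1≤j (≤-pred j<1+k))
                       (allUpTo? (λ j → (1 ≤? j) →-dec P? j) (suc k))

∀-between<? : ∀ k {P : ℕ → Set} → U.Decidable P → Dec (∀ j → 1 ≤ j → j < k → P j)
∀-between<? k P? = map′ (λ ∀P j 1≤j j<k → ∀P j<k 1≤j) (λ ∀P {j} j<k 1≤j → ∀P j 1≤j j<k)
                        (allUpTo? (λ j → (1 ≤? j) →-dec P? j) k)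

TAdj? : ∀ m → Decidable (TAdj m)
TAdj? zero    [] [] = no λ ()
TAdj? (suc m) (b ∷ v) (b' ∷ w) =
  ((b ≟ᵇ b') ×-dec TAdj? m v w) ⊎-dec (¬? (b ≟ᵇ b') ×-dec ((v ≟ᵛ root m) ×-dec (w ≟ᵛ root m)))

module Decidability (m : ℕ) where
  private
    W = Vec Bool m
    G = T (suc m)

  ∃ᵛ? : Exhaustible W
  ∃ᵛ? = Vec-exhaustible Bool-exhaustible m

  ∀ᵛ? : ∀ {P : W → Set} → U.Decidable P → Dec (∀ v → P v)
  ∀ᵛ? = ∀? ∃ᵛ?

  ColorDominating? : ∀ k c → U.Decidable (ColorDominating G k c)
  ColorDominating? k c v = ∀-between? k λ j → ¬? (j ≟ c v) →-dec ∃ᵛ? λ w → TAdj? m v w ×-dec (c w ≟ j)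

  IsProperKColoring? : ∀ k → U.Decidable (IsProperKColoring G k)
  IsProperKColoring? k c =
    ∀ᵛ? (λ v → (1 ≤? c v) ×-dec (c v ≤? k)) ×-dec
    ∀ᵛ? (λ v → ∀ᵛ? λ w → TAdj? m v w →-dec ¬? (c v ≟ c w)) ×-dec
    ∀-between? k (λ j → ∃ᵛ? λ v → c v ≟ j)

  IsGrundy? : ∀ k → U.Decidable (IsGrundy G k)
  IsGrundy? k c = IsProperKColoring? k c ×-dec
    ∀ᵛ? λ v → ∀-between<? (c v) λ i → ∃ᵛ? λ w → TAdj? m v w ×-dec (c w ≟ i)

  Central : ℕ → (W → ℕ) → Set
  Central k c = ∃ λ (u : ℕ → W) → ∀ j → 1 ≤ j → j ≤ k →
    c (u j) ≡ j × ColorDominating G k c (u j) × (j ≢ k → TAdj m (u k) (u j))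

  -- The central family u : ℕ → W of a z-colouring is found by choosing its hub u k
  -- and then each spoke u j separately.
  Spokes : ℕ → (W → ℕ) → W → Set
  Spokes k c w = ∀ j → 1 ≤ j → j ≤ k → j ≢ k → ∃ λ x → c x ≡ j × ColorDominating G k c x × TAdj m w x

  Spokes? : ∀ k c → U.Decidable (Spokes k c)
  Spokes? k c w = ∀-between? k λ j → ¬? (j ≟ k) →-dec
    ∃ᵛ? λ x → (c x ≟ j) ×-dec (ColorDominating? k c x ×-dec TAdj? m w x)

  module _ {k c w} (spokes : Spokes k c w) where

    spoke-or-hub : ℕ → W
    spoke-or-hub j with (1 ≤? j) ×-dec (j ≤? k) ×-dec ¬? (j ≟ k)
    ... | yes (1≤j , j≤k , j≢k) = proj₁ (spokes j 1≤j j≤k j≢k)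
    ... | no  _                 = w

    hub : spoke-or-hub k ≡ w
    hub with (1 ≤? k) ×-dec (k ≤? k) ×-dec ¬? (k ≟ k)
    ... | yes (_ , _ , k≢k) = ⊥-elim (k≢k refl)
    ... | no  _             = refl

    spoke : ∀ j → 1 ≤ j → j ≤ k → j ≢ k →
            c (spoke-or-hub j) ≡ j × ColorDominating G k c (spoke-or-hub j) × TAdj m w (spoke-or-hub j)
    spoke j 1≤j j≤k j≢k with (1 ≤? j) ×-dec (j ≤? k) ×-dec ¬? (j ≟ k)
    ... | yes (1≤j' , j≤k' , j≢k') = proj₂ (spokes j 1≤j' j≤k' j≢k')
    ... | no  out-of-range         = ⊥-elim (out-of-range (1≤j , j≤k , j≢k))

    hub-and-spokes : c w ≡ k → ColorDominating G k c w → Central k c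
    hub-and-spokes cw≡k dominating = spoke-or-hub , central
      where
      central : ∀ j → 1 ≤ j → j ≤ k → c (spoke-or-hub j) ≡ j × ColorDominating G k c (spoke-or-hub j) ×
                (j ≢ k → TAdj m (spoke-or-hub k) (spoke-or-hub j))
      central j 1≤j j≤k with k ≟ j
      ... | yes refl = trans (cong c hub) cw≡k , subst (ColorDominating G k c) (sym hub) dominating ,
                       λ k≢k → ⊥-elim (k≢k refl)
      ... | no  k≢j  = let (cx , dx , wx) = spoke j 1≤j j≤k (≢-sym k≢j)
                       in  cx , dx , λ _ → subst (λ x → TAdj m x (spoke-or-hub j)) (sym hub) wx

  Central? : ∀ k → U.Decidable (Central k)
  Central? zero    c = yes ((λ _ → root m) , λ { zero () ; (suc _) _ () })
  Central? (suc K) c = map′ (λ (w , cw , dw , spokes) → hub-and-spokes spokes cw dw) central⇒hub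
    (∃ᵛ? λ w → (c w ≟ suc K) ×-dec (ColorDominating? (suc K) c w ×-dec Spokes? (suc K) c w))
    where
    central⇒hub : Central (suc K) c → ∃ λ w → c w ≡ suc K × ColorDominating G (suc K) c w × Spokes (suc K) c w
    central⇒hub (u , central) =
      let (cu , du , _) = central (suc K) (s≤s z≤n) ≤-refl
      in  u (suc K) , cu , du , λ j 1≤j j≤k j≢k →
            let (cj , dj , adjacent) = central j 1≤j j≤k in u j , cj , dj , adjacent j≢k

  IsZColoring? : ∀ k → U.Decidable (IsZColoring G k)
  IsZColoring? k c = IsGrundy? k c ×-dec
    ∀-between? k (λ j → ∃ᵛ? λ v → (c v ≟ j) ×-dec ColorDominating? k c v) ×-dec
    Central? k c

by-head : ∀ {m} {A : Set} → (Vec Bool m → A) → (Vec Bool m → A) → Vec Bool (suc m) → A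
by-head f₀ f₁ (false ∷ v) = f₀ v
by-head f₀ f₁ (true  ∷ v) = f₁ v

-- Splitting c by its first bit yields a function only pointwise equal to c, hence
-- the hypothesis that P respects pointwise equality.
∃-bounded-function? : ∀ m B {P : (Vec Bool m → ℕ) → Set} →
                      (∀ {c c'} → (∀ v → c v ≡ c' v) → P c → P c') →
                      (∀ {c} → P c → ∀ v → c v ≤ B) →
                      U.Decidable P → Dec (∃ P)
∃-bounded-function? zero B resp bounded P? =
  map′ (λ (n , _ , p) → (λ _ → n) , p)
       (λ (c , p) → c [] , s≤s (bounded p []) , resp (λ { [] → refl }) p)
       (anyUpTo? (λ n → P? (λ _ → n)) (suc B))
∃-bounded-function? (suc m) B {P} resp bounded P? =
  map′ (λ (c₀ , c₁ , p) → by-head c₀ c₁ , p)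
       (λ (c , p) → c ∘ (false ∷_) , c ∘ (true ∷_) , resp (λ { (false ∷ v) → refl ; (true ∷ v) → refl }) p)
       (∃-bounded-function? m B
          (λ c₀≗c₀' (c₁ , p) → c₁ , resp (λ { (false ∷ v) → c₀≗c₀' v ; (true ∷ v) → refl }) p)
          (λ (_ , p) v → bounded p (false ∷ v))
          λ c₀ → ∃-bounded-function? m B
                   (λ c₁≗c₁' → resp (λ { (false ∷ v) → refl ; (true ∷ v) → c₁≗c₁' v }))
                   (λ p v → bounded p (true ∷ v))
                   (P? ∘ by-head c₀))

z-colourable? : ∀ m k → Dec (∃ λ c → IsZColoring (T (suc m)) k c)
z-colourable? m k = ∃-bounded-function? m k (IsZColoring-resp-≗ (T (suc m)))
  (λ (((range , _) , _) , _) v → proj₂ (range v)) (Decidability.IsZColoring? m k)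

bounded-maximum : ∀ {Q : ℕ → Set} → U.Decidable Q → ∀ B → (∀ {j} → Q j → j ≤ B) →
                  ∀ {j₀} → Q j₀ → ∃ λ z → Q z × (∀ {j} → Q j → j ≤ z)
bounded-maximum Q? B bounded q₀ with Q? B
... | yes qB = B , qB , bounded
bounded-maximum Q? zero bounded q₀ | no ¬Q0 with bounded q₀
... | z≤n = ⊥-elim (¬Q0 q₀)
bounded-maximum Q? (suc B) bounded q₀ | no ¬qB =
  bounded-maximum Q? B (λ q → ≤-pred (≤∧≢⇒< (bounded q) λ { refl → ¬qB q })) q₀

k+k∸2≤2+m⇒k+M≤1+m : ∀ M {k m} → k + (k ∸ 2) ≤ 2 + m → 2 + (M + M) ≤ m → k + M ≤ suc m
k+k∸2≤2+m⇒k+M≤1+m M {zero} _ M+M<m = m≤n⇒m≤1+n (≤-trans (m≤m+n M M) (≤-trans (n≤1+n _) (<⇒≤ M+M<m)))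
k+k∸2≤2+m⇒k+M≤1+m M {1}    _ M+M<m = s≤s (≤-trans (m≤m+n M M) (≤-trans (n≤1+n _) (<⇒≤ M+M<m)))
k+k∸2≤2+m⇒k+M≤1+m M {suc (suc d)} (s≤s (s≤s d+d≤m)) M+M<m with d ≤? M
... | yes d≤M = s≤s (≤-trans (s≤s (+-monoˡ-≤ M d≤M)) (<⇒≤ M+M<m))
... | no  d≰M = s≤s (≤-trans (+-monoʳ-< d (≰⇒> d≰M)) d+d≤m)

theorem5 : ∀ (M : ℕ) → ∃[ K ] ∀ (k : ℕ) → 1 ≤ k → K ≤ k →
    ∃[ g ] ∃[ z ] (GrundyNumberIs (T k) g × ZNumberIs (T k) z × z + M ≤ g)
theorem5 M = 3 + (M + M) , gap
  where
  gap : ∀ k → 1 ≤ k → 3 + (M + M) ≤ k →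
        ∃[ g ] ∃[ z ] (GrundyNumberIs (T k) g × ZNumberIs (T k) z × z + M ≤ g)
  gap (suc m) _ (s≤s K≤m) =
    let (_ , some-z) = some-z-colouring m
        (z , (c , z-colouring) , z-maximal) =
          bounded-maximum (z-colourable? m) (suc m) (λ (_ , z-col) → grundy-bound m (proj₁ z-col)) some-z
    in  suc m , z ,
        ((_ , level-colouring-grundy m) , λ _ _ → grundy-bound m) ,
        ((c , z-colouring) , λ _ c' z-col → z-maximal (c' , z-col)) ,
        k+k∸2≤2+m⇒k+M≤1+m M (z-colouring-bound m z-colouring) K≤m
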